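{- Let $\beta\in S_n$ and let $m$ be the maximum length of a cycle in the disjoint cycle decomposition of $\beta$. Let $\alpha\in S_n$ and let $\beta_j$ be an $m$-cycle of $\beta$. If $\alpha\beta(b)=\beta\alpha(b)$ holds for $m-1$ of the points $b$ of $\beta_j$, then it holds for all points of $\beta_j$.
   Context: $S_n$ is the symmetric group on $[n]$, products composed right to left. -}

module Defs where

open import Data.Nat using (ℕ; zero; suc; _≤_; _<_)
open import Data.Fin using (Fin)
open import Data.Fin.Permutation using (Permutation′; _⟨$⟩ʳ_)
open import Data.Product using (_×_; ∃)
open import Relation.Binary.PropositionalEquality using (_≡_; _≢_)

pow : ∀ {n} → Permutation′ n → ℕ → Fin n → Fin n
pow β zero    x = x
pow β (suc k) x = β ⟨$⟩ʳ pow β k x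

CycleLength : ∀ {n} → Permutation′ n → Fin n → ℕ → Set
CycleLength β x k =
  (1 ≤ k) × (pow β k x ≡ x) × (∀ j → 1 ≤ j → j < k → pow β j x ≢ x)

MaxCycleLength : ∀ {n} → Permutation′ n → ℕ → Set
MaxCycleLength β m =
  (∃ λ x → CycleLength β x m) × (∀ y k → CycleLength β y k → k ≤ m)

-- αβ(b) = βα(b), products composed right to left
CommutesAt : ∀ {n} → Permutation′ n → Permutation′ n → Fin n → Set
CommutesAt α β b = α ⟨$⟩ʳ (β ⟨$⟩ʳ b) ≡ β ⟨$⟩ʳ (α ⟨$⟩ʳ b)

module Submission where

-- Put y := β^(i₀+1) x, the point just after the exceptional one, so that α commutes with β
-- at y, βy, …, β^(m-2) y, and set z := α y. Then α(β^j y) = β^j z for j ≤ m - 1; since α is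
-- injective and y lies on an m-cycle, z has no period below m, and since m is the maximal
-- cycle length, z lies on an m-cycle too. Hence αβ(β^(m-1) y) = α y = z = β^m z = βα(β^(m-1) y),
-- which is the missing commutation at β^(m-1) y = β^(i₀) x.

open import Defs
open import Data.Nat using (ℕ; zero; suc; _+_; _∸_; _≤_; _<_; s≤s; _≤?_; _<?_; _≟_)
open import Data.Nat.Properties
open import Data.Nat.Induction using (<-rec)
open import Data.Fin using (Fin; toℕ)
import Data.Fin.Properties as Finₚ
open import Data.Fin.Permutation using (Permutation′; _⟨$⟩ʳ_)
open import Data.Product using (_×_; _,_; ∃)
open import Function.Bundles using (Injection)
open import Function.Properties.Inverse using (↔⇒↣)
open import Relation.Nullary using (yes; no; contradiction)
open import Relation.Nullary.Decidable using (_×-dec_)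
open import Relation.Binary.PropositionalEquality

⟨$⟩ʳ-injective : ∀ {n} (π : Permutation′ n) {a b : Fin n} → π ⟨$⟩ʳ a ≡ π ⟨$⟩ʳ b → a ≡ b
⟨$⟩ʳ-injective π = Injection.injective (↔⇒↣ π)

module _ {n : ℕ} (β : Permutation′ n) where

  pow-+ : ∀ a b y → pow β (a + b) y ≡ pow β a (pow β b y)
  pow-+ zero    b y = refl
  pow-+ (suc a) b y = cong (β ⟨$⟩ʳ_) (pow-+ a b y)

  pow-comm : ∀ a b y → pow β a (pow β b y) ≡ pow β b (pow β a y)
  pow-comm a b y = begin
    pow β a (pow β b y) ≡⟨ pow-+ a b y ⟨
    pow β (a + b) y     ≡⟨ cong (λ c → pow β c y) (+-comm a b) ⟩
    pow β (b + a) y     ≡⟨ pow-+ b a y ⟩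
    pow β b (pow β a y) ∎
    where open ≡-Reasoning

  pow-injective : ∀ k {a b} → pow β k a ≡ pow β k b → a ≡ b
  pow-injective zero    e = e
  pow-injective (suc k) e = pow-injective k (⟨$⟩ʳ-injective β e)

  pow-periodic : ∀ {m y} → pow β m y ≡ y → ∀ r → pow β (r + m) y ≡ pow β r y
  pow-periodic {m} {y} βᵐy≡y r = trans (pow-+ r m y) (cong (pow β r) βᵐy≡y)

  holds-on-orbit-after : ∀ {ℓ} (P : Fin n → Set ℓ) {m x i₀} → pow β m x ≡ x → i₀ < m →
    (∀ i → i < m → i ≢ i₀ → P (pow β i x)) → ∀ t → i₀ < t → t < m + i₀ → P (pow β t x)
  holds-on-orbit-after P {m} {x} {i₀} βᵐx≡x i₀<m holds t i₀<t t<m+i₀ with t <? m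
  ... | yes t<m = holds t t<m (>⇒≢ i₀<t)
  ... | no t≮m  = subst P (sym βᵗx≡βʳx) (holds r (<-trans r<i₀ i₀<m) (<⇒≢ r<i₀))
    where
    r = t ∸ m
    r<i₀ : r < i₀
    r<i₀ = subst (r <_) (m+n∸m≡n m i₀) (∸-monoˡ-< t<m+i₀ (≮⇒≥ t≮m))
    βᵗx≡βʳx : pow β t x ≡ pow β r x
    βᵗx≡βʳx = trans (cong (λ c → pow β c x) (sym (m∸n+n≡m (≮⇒≥ t≮m)))) (pow-periodic βᵐx≡x r)

  -- Pigeonhole on the n + 1 points y, βy, …, βⁿy.
  period-exists : ∀ y → ∃ λ K → 1 ≤ K × pow β K y ≡ y
  period-exists y with Finₚ.pigeonhole (n<1+n n) (λ i → pow β (toℕ i) y)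
  ... | i , j , i<j , βⁱy≡βʲy = toℕ j ∸ toℕ i , m<n⇒0<n∸m i<j , pow-injective (toℕ i) (begin
    pow β (toℕ i) (pow β d y) ≡⟨ pow-+ (toℕ i) d y ⟨
    pow β (toℕ i + d) y       ≡⟨ cong (λ c → pow β c y) (m+[n∸m]≡n (<⇒≤ i<j)) ⟩
    pow β (toℕ j) y           ≡⟨ βⁱy≡βʲy ⟨
    pow β (toℕ i) y           ∎)
    where
    open ≡-Reasoning
    d = toℕ j ∸ toℕ i

  cycleLength-from-period : ∀ y K → 1 ≤ K → pow β K y ≡ y → ∃ (CycleLength β y)
  cycleLength-from-period y = <-rec _ step
    where
    step : ∀ K → (∀ {J} → J < K → 1 ≤ J → pow β J y ≡ y → ∃ (CycleLength β y)) →
           1 ≤ K → pow β K y ≡ y → ∃ (CycleLength β y)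
    step K shorter 1≤K βᴷy≡y with anyUpTo? (λ J → 1 ≤? J ×-dec pow β J y Finₚ.≟ y) K
    ... | yes (J , J<K , 1≤J , βᴶy≡y) = shorter J<K 1≤J βᴶy≡y
    ... | no no-shorter = K , 1≤K , βᴷy≡y ,
      λ J 1≤J J<K βᴶy≡y → no-shorter (J , J<K , 1≤J , βᴶy≡y)

  cycleLength-exists : ∀ y → ∃ (CycleLength β y)
  cycleLength-exists y with K , 1≤K , βᴷy≡y ← period-exists y = cycleLength-from-period y K 1≤K βᴷy≡y

  cycleLength-pow : ∀ {y k} → CycleLength β y k → ∀ j → CycleLength β (pow β j y) k
  cycleLength-pow {y} {k} (1≤k , βᵏy≡y , minimal) j =
    1≤k ,
    trans (pow-comm k j y) (cong (pow β j) βᵏy≡y) ,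
    λ i 1≤i i<k βⁱβʲy≡βʲy → minimal i 1≤i i<k
      (pow-injective j (trans (pow-comm j i y) βⁱβʲy≡βʲy))

  maxCycleLength-period : ∀ {m z} → MaxCycleLength β m →
    (∀ j → 1 ≤ j → j < m → pow β j z ≢ z) → pow β m z ≡ z
  maxCycleLength-period {m} {z} (_ , maximal) aperiodic
    with k , cyc@(1≤k , βᵏz≡z , _) ← cycleLength-exists z with k <? m
  ... | yes k<m = contradiction βᵏz≡z (aperiodic k 1≤k k<m)
  ... | no k≮m  = subst (λ c → pow β c z ≡ z) (≤-antisym (maximal z k cyc) (≮⇒≥ k≮m)) βᵏz≡z

module _ {n : ℕ} (α β : Permutation′ n) where

  commutes-along-orbit : ∀ {y} k → (∀ j → j < k → CommutesAt α β (pow β j y)) →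
    α ⟨$⟩ʳ pow β k y ≡ pow β k (α ⟨$⟩ʳ y)
  commutes-along-orbit zero    _        = refl
  commutes-along-orbit (suc k) commutes =
    trans (commutes k ≤-refl)
          (cong (β ⟨$⟩ʳ_) (commutes-along-orbit k (λ j j<k → commutes j (m<n⇒m<1+n j<k))))

  commutesAt-end-of-maxCycle : ∀ {k y} → MaxCycleLength β (suc k) → CycleLength β y (suc k) →
    (∀ j → j < k → CommutesAt α β (pow β j y)) → CommutesAt α β (pow β k y)
  commutesAt-end-of-maxCycle {k} {y} max (_ , βᵐy≡y , minimal) commutes = begin
    α ⟨$⟩ʳ pow β (suc k) y   ≡⟨ cong (α ⟨$⟩ʳ_) βᵐy≡y ⟩
    z                        ≡⟨ maxCycleLength-period β max z-aperiodic ⟨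
    pow β (suc k) z          ≡⟨ cong (β ⟨$⟩ʳ_) (α∘βʲ≡βʲ∘α k ≤-refl) ⟨
    β ⟨$⟩ʳ (α ⟨$⟩ʳ pow β k y) ∎
    where
    open ≡-Reasoning
    z = α ⟨$⟩ʳ y

    α∘βʲ≡βʲ∘α : ∀ j → j ≤ k → α ⟨$⟩ʳ pow β j y ≡ pow β j z
    α∘βʲ≡βʲ∘α j j≤k = commutes-along-orbit j (λ i i<j → commutes i (<-≤-trans i<j j≤k))

    z-aperiodic : ∀ j → 1 ≤ j → j < suc k → pow β j z ≢ z
    z-aperiodic j 1≤j j<m βʲz≡z = minimal j 1≤j j<m
      (⟨$⟩ʳ-injective α (trans (α∘βʲ≡βʲ∘α j (m<1+n⇒m≤n j<m)) βʲz≡z))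

proposition4 : (n : ℕ) (β α : Permutation′ n) (m : ℕ) → MaxCycleLength β m →
    (x : Fin n) → CycleLength β x m →
    (i₀ : ℕ) → i₀ < m →
    (∀ i → i < m → i ≢ i₀ → CommutesAt α β (pow β i x)) →
    ∀ i → i < m → CommutesAt α β (pow β i x)
proposition4 n β α (suc k) max x cyc@(_ , βᵐx≡x , _) i₀ i₀<m commutes i i<m with i ≟ i₀
... | no i≢i₀  = commutes i i<m i≢i₀
... | yes refl = subst (CommutesAt α β) βᵏy≡βⁱ⁰x
  (commutesAt-end-of-maxCycle α β max (cycleLength-pow β cyc (suc i₀)) commutes-after)
  where
  y = pow β (suc i₀) x

  commutes-after : ∀ j → j < k → CommutesAt α β (pow β j y)
  commutes-after j j<k = subst (CommutesAt α β) (pow-+ β j (suc i₀) x)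
    (holds-on-orbit-after β (CommutesAt α β) βᵐx≡x i₀<m commutes (j + suc i₀) (m≤n+m (suc i₀) j)
      (subst (_< suc k + i₀) (sym (+-suc j i₀)) (s≤s (+-monoˡ-< i₀ j<k))))

  βᵏy≡βⁱ⁰x : pow β k y ≡ pow β i₀ x
  βᵏy≡βⁱ⁰x = begin
    pow β k y               ≡⟨ pow-+ β k (suc i₀) x ⟨
    pow β (k + suc i₀) x    ≡⟨ cong (λ c → pow β c x) (trans (+-suc k i₀) (+-comm (suc k) i₀)) ⟩
    pow β (i₀ + suc k) x    ≡⟨ pow-periodic β βᵐx≡x i₀ ⟩
    pow β i₀ x              ∎
    where open ≡-Reasoning
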